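{- Let $n\ge 23$ and $S_{1,4}=\{+1,-1,+4,-4\}$. In the Cayley graph $\Gamma(\mathbb Z/n\mathbb Z,S_{1,4})$, every type A edge $\{g,g+1\}$ has Ricci curvature $\kappa=\frac14$ and every type B edge $\{g,g+4\}$ has Ricci curvature $\kappa=0$.
   Context: Let $G=(V,E)$ be a finite connected simple undirected graph with graph distance $d$, $N(x)$ the set of neighbors of $x$, and $\deg(x)=|N(x)|$. For $\alpha\in[0,1]$ and $x\in V$ define the probability measure $\mu_x^\alpha$ on $V$ by $\mu_x^\alpha(x)=\alpha$, $\mu_x^\alpha(v)=\frac{1-\alpha}{\deg(x)}$ for $v\in N(x)$, and $\mu_x^\alpha(v)=0$ otherwise. For probability measures $\mu,\nu$ on $V$, the 1-Wasserstein distance is $W_1(\mu,\nu)=\inf_\pi\sum_{x,y\in V}d(x,y)\pi(x,y)$, the infimum over all $\pi:V\times V\to[0,1]$ with $\sum_y\pi(x,y)=\mu(x)$ and $\sum_x\pi(x,y)=\nu(y)$. For $x\neq y$, $\kappa_\alpha(x,y)=1-\frac{W_1(\mu_x^\alpha,\mu_y^\alpha)}{d(x,y)}$, and the Ricci curvature (of Lin–Lu–Yau) is $\kappa(x,y)=\lim_{\alpha\to1}\frac{\kappa_\alpha(x,y)}{1-\alpha}$. For the additive cyclic group $\mathbb Z/n\mathbb Z$ and a symmetric generating set $S$ not containing $0$, the Cayley graph $\Gamma(\mathbb Z/n\mathbb Z,S)$ is the simple undirected graph with vertex set $\mathbb Z/n\mathbb Z$ and edge set $\{\{g,g+s\}: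 g\in\mathbb Z/n\mathbb Z,\ s\in S\}$.
   Formalization: The parameter α in the limit α → 1 ranges over the rationals, and the couplings π in the infimum defining the 1-Wasserstein distance take rational values. -}

module Defs where

open import Data.Bool using (Bool; true; false; if_then_else_; T; _∨_)
open import Data.Nat as ℕ using (ℕ; zero; suc; _∸_)
open import Data.Nat.DivMod using (_%_; m%n<n)
open import Data.Fin as Fin using (Fin; toℕ; fromℕ<)
open import Data.Fin.Properties using () renaming (_≟_ to _≟ᶠ_)
open import Data.Integer using (+_)
open import Data.Rational as ℚ using (ℚ; 0ℚ; 1ℚ; _+_; _*_; _-_; _÷_; ∣_∣; _≤_; _<_; _/_)
open import Data.Rational.Properties using () renaming (_≟_ to _≟ℚ_)
open import Data.List using (List; []; _∷_)
open import Data.Bool.ListAction using (any)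
open import Data.Product using (Σ; _×_; ∃)
open import Relation.Nullary using (yes; no)
open import Relation.Nullary.Decidable using (⌊_⌋)
open import Relation.Binary.PropositionalEquality using (_≡_)

Graph : ℕ → Set
Graph n = Fin n → Fin n → Bool

ℕ→ℚ : ℕ → ℚ
ℕ→ℚ k = + k / 1

-- total division on ℚ (only ever used with nonzero divisor)
_/ₜ_ : ℚ → ℚ → ℚ
p /ₜ q with q ≟ℚ 0ℚ
... | yes _  = 0ℚ
... | no q≢0 = _÷_ p q {{ℚ.≢-nonZero q≢0}}

sumℕ : {n : ℕ} → (Fin n → ℕ) → ℕ
sumℕ {zero}  f = 0
sumℕ {suc n} f = f Fin.zero ℕ.+ sumℕ (λ i → f (Fin.suc i))

sumℚ : {n : ℕ} → (Fin n → ℚ) → ℚ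
sumℚ {zero}  f = 0ℚ
sumℚ {suc n} f = f Fin.zero + sumℚ (λ i → f (Fin.suc i))

deg : {n : ℕ} → Graph n → Fin n → ℕ
deg G x = sumℕ (λ v → if G x v then 1 else 0)

data Walk {n : ℕ} (G : Graph n) : Fin n → Fin n → ℕ → Set where
  here : ∀ {x} → Walk G x x 0
  step : ∀ {x z y k} → T (G x z) → Walk G z y k → Walk G x y (suc k)

IsGraphDistance : {n : ℕ} → Graph n → (Fin n → Fin n → ℕ) → Set
IsGraphDistance G d =
  ∀ x y → Walk G x y (d x y) × (∀ k → Walk G x y k → d x y ℕ.≤ k)

μ : {n : ℕ} → Graph n → ℚ → Fin n → (Fin n → ℚ)
μ G α x v =
  if ⌊ v ≟ᶠ x ⌋ then α
  else if G x v then (1ℚ - α) /ₜ ℕ→ℚ (deg G x)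
  else 0ℚ

IsCoupling : {n : ℕ} → (Fin n → ℚ) → (Fin n → ℚ) → (Fin n → Fin n → ℚ) → Set
IsCoupling m₁ m₂ π =
  (∀ x y → 0ℚ ≤ π x y) ×
  (∀ x → sumℚ (λ y → π x y) ≡ m₁ x) ×
  (∀ y → sumℚ (λ x → π x y) ≡ m₂ y)

cost : {n : ℕ} → (Fin n → Fin n → ℕ) → (Fin n → Fin n → ℚ) → ℚ
cost d π = sumℚ (λ x → sumℚ (λ y → ℕ→ℚ (d x y) * π x y))

IsW1 : {n : ℕ} → (Fin n → Fin n → ℕ) → (Fin n → ℚ) → (Fin n → ℚ) → ℚ → Set
IsW1 d m₁ m₂ w =
  (Σ (_ → _ → ℚ) λ π → IsCoupling m₁ m₂ π × cost d π ≡ w) ×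
  (∀ π → IsCoupling m₁ m₂ π → w ≤ cost d π)

-- Lin–Lu–Yau Ricci curvature:  κ(x,y) = lim_{α→1} κ_α(x,y)/(1-α),
-- κ_α(x,y) = 1 - W₁(μ_x^α, μ_y^α)/d(x,y).
-- "HasCurvature G d x y κ" says this limit exists and equals κ
-- (ε-δ, with α ranging over rationals in [0,1)).

κα : ℚ → ℕ → ℚ
κα w dxy = 1ℚ - (w /ₜ ℕ→ℚ dxy)

HasCurvature : {n : ℕ} → Graph n → (Fin n → Fin n → ℕ) → Fin n → Fin n → ℚ → Set
HasCurvature G d x y κ =
  ∀ ε → 0ℚ < ε →
    Σ ℚ λ δ → 0ℚ < δ ×
      (∀ α → 0ℚ ≤ α → (1ℚ - δ) < α → α < 1ℚ →
         Σ ℚ λ w → IsW1 d (μ G α x) (μ G α y) w ×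
           ∣ (κα w (d x y) /ₜ (1ℚ - α)) - κ ∣ < ε)

-- Cayley graphs of ℤ/nℤ.  Elements of ℤ/nℤ are Fin n (residues);
-- a generator is given by its residue in {0,…,n-1} (as ℕ).

_⊕_ : {n : ℕ} → Fin n → ℕ → Fin n
_⊕_ {suc m} g s = fromℕ< (m%n<n (toℕ g ℕ.+ s) (suc m))

Cayley : (n : ℕ) → List ℕ → Graph n
Cayley n S x y = any (λ s → ⌊ y ≟ᶠ (x ⊕ s) ⌋) S

S₁₄ : ℕ → List ℕ
S₁₄ n = 1 ∷ (n ∸ 1) ∷ 4 ∷ (n ∸ 4) ∷ []

-- For α close to 1 the optimal transport between μ_x^α and μ_y^α can be written down.  An explicit
-- transport plan bounds W₁ from above, and a 1-Lipschitz potential f bounds it from below, because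
-- Σ f μ_x − Σ f μ_y ≤ W₁(μ_x, μ_y) (the easy half of Kantorovich duality).  For n ≥ 23 the
-- vertices g − 12, …, g + 10 are distinct and the distances between them that matter are those
-- of the Cayley graph of ℤ, so all computations happen in these local coordinates.  With
-- β = (1 − α)/4:
--  * edge {g, g+1}: keep β at g, move α − β from g to g+1, and move g−1, g+4, g−4 to g+2, g+5, g−3;
--    the potential is the distance to {g−3, g+1, g+2}, and W₁ = 1 − β;
--  * edge {g, g+4}: move g, g+1, g−1, g+4, g−4 to g+4, g+5, g+3, g+8, g; the potential is the
--    distance to g+8, and W₁ = 1.
-- Hence κ_α/(1 − α) equals 1/4, resp. 0, for every α ∈ (1/2, 1), and so does its limit.

module Submission where

open import Defs
open import Algebra.Bundles using (Ring)
open import Data.Bool using (true; false; T; if_then_else_)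
open import Data.Bool.ListAction using (any)
open import Data.Empty using (⊥-elim)
open import Data.Fin as Fin using (Fin; toℕ; punchIn)
open import Data.Fin.Properties using (toℕ-fromℕ<; toℕ-injective; toℕ<n; punchInᵢ≢i) renaming (_≟_ to _≟ᶠ_)
import Data.Integer as ℤ
import Data.Integer.Properties as ℤ
open import Data.List using (List; []; _∷_; map; length)
open import Data.List.Membership.Propositional using (_∈_; _∉_)
open import Data.List.Properties using (length-map)
import Data.List.Relation.Unary.AllPairs as AllPairs
open import Data.List.Relation.Unary.All as All using (All; []; _∷_; all?)
open import Data.List.Relation.Unary.All.Properties using (¬Any⇒All¬; All¬⇒¬Any)
open import Data.List.Relation.Unary.Any as Any using (here; there)
open import Data.List.Relation.Unary.Any.Properties using (any⁺; any⁻) renaming (map⁺ to Any-map⁺; map⁻ to Any-map⁻)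
open import Data.List.Relation.Unary.Unique.Propositional using (Unique; []; _∷_)
open import Data.List.Relation.Binary.Pointwise using (Pointwise; []; _∷_)
open import Data.Nat as ℕ using (ℕ; zero; suc; z≤n; s≤s)
open import Data.Nat.Coprimality using (1-coprimeTo) renaming (sym to coprime-sym)
open import Data.Nat.DivMod using (_%_; %-distribˡ-+; m%n%n≡m%n; [m+n]%n≡m%n; m<n⇒m%n≡m)
import Data.Nat.Properties as ℕ
open import Data.List.Membership.DecPropositional ℕ._≟_ using (_∈?_; _∉?_)
open import Data.List.Relation.Unary.Unique.DecPropositional ℕ._≟_ using (unique?)
open import Data.Product using (Σ; _×_; _,_; proj₁; proj₂)
open import Data.Rational using (ℚ; 0ℚ; 1ℚ; _+_; _*_; _-_; -_; _≤_; _<_; ∣_∣; _/_; 1/_; mkℚ; toℚᵘ; *≤*; ≢-nonZero; nonNegative)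
open import Data.Rational.Properties
import Data.Rational.Unnormalised as ℚᵘ
import Data.Rational.Unnormalised.Properties as ℚᵘ
open import Data.Rational.Solver using (module +-*-Solver)
open import Data.Sum as Sum using (_⊎_; inj₁; inj₂)
open import Function using (_∘_; _⇔_; mk⇔; Equivalence)
open import Relation.Nullary using (¬_; Dec; yes; no)
open import Relation.Nullary.Decidable using (⌊_⌋; True; toWitness; fromWitness; _×-dec_; ¬?)
open import Relation.Binary.PropositionalEquality

open import Algebra.Properties.Group +-0-group using (x∙y⁻¹≈ε⇒x≈y)
open import Algebra.Properties.Semiring.Sum (Ring.semiring +-*-ring)
open +-*-Solver using (Polynomial; con; _:+_; _:*_; _:-_; _:=_; solve)

module _ {m : ℕ} where
  private
    N : ℕ
    N = suc m

  toℕ-⊕ : (x : Fin N) (s : ℕ) → toℕ (x ⊕ s) ≡ (toℕ x ℕ.+ s) % N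
  toℕ-⊕ x s = toℕ-fromℕ< _

  [m%n+k]%n≡[m+k]%n : ∀ a b → (a % N ℕ.+ b) % N ≡ (a ℕ.+ b) % N
  [m%n+k]%n≡[m+k]%n a b = begin
      (a % N ℕ.+ b) % N            ≡⟨ %-distribˡ-+ (a % N) b N ⟩
      (a % N % N ℕ.+ b % N) % N    ≡⟨ cong (λ r → (r ℕ.+ b % N) % N) (m%n%n≡m%n a N) ⟩
      (a % N ℕ.+ b % N) % N        ≡⟨ %-distribˡ-+ a b N ⟨
      (a ℕ.+ b) % N                ∎
    where open ≡-Reasoning

  ⊕-assoc : (x : Fin N) (a b : ℕ) → (x ⊕ a) ⊕ b ≡ x ⊕ (a ℕ.+ b)
  ⊕-assoc x a b = toℕ-injective (begin
      toℕ ((x ⊕ a) ⊕ b)              ≡⟨ toℕ-⊕ (x ⊕ a) b ⟩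
      (toℕ (x ⊕ a) ℕ.+ b) % N        ≡⟨ cong (λ r → (r ℕ.+ b) % N) (toℕ-⊕ x a) ⟩
      ((toℕ x ℕ.+ a) % N ℕ.+ b) % N  ≡⟨ [m%n+k]%n≡[m+k]%n (toℕ x ℕ.+ a) b ⟩
      (toℕ x ℕ.+ a ℕ.+ b) % N        ≡⟨ cong (_% N) (ℕ.+-assoc (toℕ x) a b) ⟩
      (toℕ x ℕ.+ (a ℕ.+ b)) % N      ≡⟨ toℕ-⊕ x (a ℕ.+ b) ⟨
      toℕ (x ⊕ (a ℕ.+ b))            ∎)
    where open ≡-Reasoning

  ⊕-periodic : (x : Fin N) (a : ℕ) → x ⊕ (a ℕ.+ N) ≡ x ⊕ a
  ⊕-periodic x a = toℕ-injective (begin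
      toℕ (x ⊕ (a ℕ.+ N))          ≡⟨ toℕ-⊕ x (a ℕ.+ N) ⟩
      (toℕ x ℕ.+ (a ℕ.+ N)) % N    ≡⟨ cong (_% N) (ℕ.+-assoc (toℕ x) a N) ⟨
      (toℕ x ℕ.+ a ℕ.+ N) % N      ≡⟨ [m+n]%n≡m%n (toℕ x ℕ.+ a) N ⟩
      (toℕ x ℕ.+ a) % N            ≡⟨ toℕ-⊕ x a ⟨
      toℕ (x ⊕ a)                  ∎)
    where open ≡-Reasoning

  ⊕-identityʳ : (x : Fin N) → x ⊕ 0 ≡ x
  ⊕-identityʳ x = toℕ-injective (begin
      toℕ (x ⊕ 0)         ≡⟨ toℕ-⊕ x 0 ⟩
      (toℕ x ℕ.+ 0) % N   ≡⟨ cong (_% N) (ℕ.+-identityʳ (toℕ x)) ⟩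
      toℕ x % N           ≡⟨ m<n⇒m%n≡m (toℕ<n x) ⟩
      toℕ x               ∎)
    where open ≡-Reasoning

  -- Translating back by N ∸ toℕ x recovers the offset.
  ⊕-cancelˡ : (x : Fin N) {k k′ : ℕ} → k ℕ.< N → k′ ℕ.< N → x ⊕ k ≡ x ⊕ k′ → k ≡ k′
  ⊕-cancelˡ x {k} {k′} k<N k′<N eq = begin
      k                                  ≡⟨ recover k k<N ⟨
      ((t ℕ.+ k) % N ℕ.+ (N ℕ.∸ t)) % N   ≡⟨ cong (λ r → (r ℕ.+ (N ℕ.∸ t)) % N) t+k≡t+k′ ⟩
      ((t ℕ.+ k′) % N ℕ.+ (N ℕ.∸ t)) % N  ≡⟨ recover k′ k′<N ⟩
      k′                                 ∎
    where
    open ≡-Reasoning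
    t : ℕ
    t = toℕ x
    t+k≡t+k′ : (t ℕ.+ k) % N ≡ (t ℕ.+ k′) % N
    t+k≡t+k′ = trans (sym (toℕ-⊕ x k)) (trans (cong toℕ eq) (toℕ-⊕ x k′))
    recover : ∀ j → j ℕ.< N → ((t ℕ.+ j) % N ℕ.+ (N ℕ.∸ t)) % N ≡ j
    recover j j<N = begin
      ((t ℕ.+ j) % N ℕ.+ (N ℕ.∸ t)) % N  ≡⟨ [m%n+k]%n≡[m+k]%n (t ℕ.+ j) (N ℕ.∸ t) ⟩
      (t ℕ.+ j ℕ.+ (N ℕ.∸ t)) % N        ≡⟨ cong (λ r → (r ℕ.+ (N ℕ.∸ t)) % N) (ℕ.+-comm t j) ⟩
      (j ℕ.+ t ℕ.+ (N ℕ.∸ t)) % N        ≡⟨ cong (_% N) (ℕ.+-assoc j t (N ℕ.∸ t)) ⟩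
      (j ℕ.+ (t ℕ.+ (N ℕ.∸ t))) % N      ≡⟨ cong (λ r → (j ℕ.+ r) % N) (ℕ.m+[n∸m]≡n (ℕ.<⇒≤ (toℕ<n x))) ⟩
      (j ℕ.+ N) % N                      ≡⟨ [m+n]%n≡m%n j N ⟩
      j % N                              ≡⟨ m<n⇒m%n≡m j<N ⟩
      j                                  ∎

cayley-adjacent⇔ : ∀ {n} (S : List ℕ) {x y : Fin n} → T (Cayley n S x y) ⇔ y ∈ map (x ⊕_) S
cayley-adjacent⇔ S = mk⇔ (Any-map⁺ ∘ Any.map toWitness ∘ any⁻ _ S)
                         (any⁺ _ ∘ Any.map fromWitness ∘ Any-map⁻)

walk-++ : ∀ {n} {G : Graph n} {x y z a b} → Walk G x y a → Walk G y z b → Walk G x z (a ℕ.+ b)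
walk-++ here w′ = w′
walk-++ (step e w) w′ = step e (walk-++ w w′)

Lipschitz : ∀ {n} → (Fin n → Fin n → ℕ) → (Fin n → ℕ) → Set
Lipschitz d f = ∀ u v → f u ℕ.≤ d u v ℕ.+ f v

⊓-Lipschitz : ∀ {n} {d : Fin n → Fin n → ℕ} {f g} → Lipschitz d f → Lipschitz d g → Lipschitz d (λ v → f v ℕ.⊓ g v)
⊓-Lipschitz {d = d} {f} {g} lip-f lip-g u v = begin
    f u ℕ.⊓ g u                           ≤⟨ ℕ.⊓-mono-≤ (lip-f u v) (lip-g u v) ⟩
    (d u v ℕ.+ f v) ℕ.⊓ (d u v ℕ.+ g v)   ≡⟨ ℕ.+-distribˡ-⊓ (d u v) (f v) (g v) ⟨
    d u v ℕ.+ (f v ℕ.⊓ g v)               ∎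
  where open ℕ.≤-Reasoning

module GraphDistance {n : ℕ} {G : Graph n} {d : Fin n → Fin n → ℕ} (isDist : IsGraphDistance G d) where

  d≤walk : ∀ {x y k} → Walk G x y k → d x y ℕ.≤ k
  d≤walk = proj₂ (isDist _ _) _

  d-refl : ∀ x → d x x ≡ 0
  d-refl x = ℕ.n≤0⇒n≡0 (d≤walk here)

  d≤1 : ∀ {x y} → T (G x y) → d x y ℕ.≤ 1
  d≤1 e = d≤walk (step e here)

  d-triangle : ∀ x y z → d x z ℕ.≤ d x y ℕ.+ d y z
  d-triangle x y z = d≤walk (walk-++ (proj₁ (isDist x y)) (proj₁ (isDist y z)))

  d-Lipschitz : ∀ t → Lipschitz d (λ v → d v t)
  d-Lipschitz t u v = d-triangle u v t

  private
    walk≥1 : ∀ {x y k} → Walk G x y k → x ≢ y → 1 ℕ.≤ k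
    walk≥1 here x≢y = ⊥-elim (x≢y refl)
    walk≥1 (step _ _) _ = s≤s z≤n

    walk≥2 : ∀ {x y k} → Walk G x y k → x ≢ y → ¬ T (G x y) → 2 ℕ.≤ k
    walk≥2 here x≢y _ = ⊥-elim (x≢y refl)
    walk≥2 (step e here) _ ¬xy = ⊥-elim (¬xy e)
    walk≥2 (step _ (step _ _)) _ _ = s≤s (s≤s z≤n)

    walk≥3 : ∀ {x y k} → Walk G x y k → x ≢ y → ¬ T (G x y) →
             (∀ z → T (G x z) → ¬ T (G z y)) → 3 ℕ.≤ k
    walk≥3 here x≢y _ _ = ⊥-elim (x≢y refl)
    walk≥3 (step e here) _ ¬xy _ = ⊥-elim (¬xy e)
    walk≥3 (step {z = z} e (step e′ here)) _ _ noCommon = ⊥-elim (noCommon z e e′)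
    walk≥3 (step _ (step _ (step _ _))) _ _ _ = s≤s (s≤s (s≤s z≤n))

  1≤d : ∀ {x y} → x ≢ y → 1 ℕ.≤ d x y
  1≤d = walk≥1 (proj₁ (isDist _ _))

  2≤d : ∀ {x y} → x ≢ y → ¬ T (G x y) → 2 ℕ.≤ d x y
  2≤d = walk≥2 (proj₁ (isDist _ _))

  3≤d : ∀ {x y} → x ≢ y → ¬ T (G x y) → (∀ z → T (G x z) → ¬ T (G z y)) → 3 ℕ.≤ d x y
  3≤d = walk≥3 (proj₁ (isDist _ _))

ℕ→ℚ≡mkℚ : ∀ k → ℕ→ℚ k ≡ mkℚ (ℤ.+ k) 0 (coprime-sym (1-coprimeTo k))
ℕ→ℚ≡mkℚ k = normalize-coprime (coprime-sym (1-coprimeTo k))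

private
  ℕ→ℚᵘ : ℕ → ℚᵘ.ℚᵘ
  ℕ→ℚᵘ k = ℚᵘ.mkℚᵘ (ℤ.+ k) 0

  ℕ→ℚᵘ-+ : ∀ a b → ℕ→ℚᵘ (a ℕ.+ b) ℚᵘ.≃ ℕ→ℚᵘ a ℚᵘ.+ ℕ→ℚᵘ b
  ℕ→ℚᵘ-+ a b = ℚᵘ.*≡* (begin
      ℤ.+ (a ℕ.+ b) ℤ.* ℤ.+ 1                          ≡⟨ ℤ.*-identityʳ _ ⟩
      ℤ.+ (a ℕ.+ b)                                    ≡⟨ ℤ.pos-+ a b ⟩
      ℤ.+ a ℤ.+ ℤ.+ b                                  ≡⟨ cong₂ ℤ._+_ (ℤ.*-identityʳ (ℤ.+ a)) (ℤ.*-identityʳ (ℤ.+ b)) ⟨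
      ℤ.+ a ℤ.* ℤ.+ 1 ℤ.+ ℤ.+ b ℤ.* ℤ.+ 1              ≡⟨ ℤ.*-identityʳ _ ⟨
      (ℤ.+ a ℤ.* ℤ.+ 1 ℤ.+ ℤ.+ b ℤ.* ℤ.+ 1) ℤ.* ℤ.+ 1  ∎)
    where open ≡-Reasoning

ℕ→ℚ-+ : ∀ a b → ℕ→ℚ (a ℕ.+ b) ≡ ℕ→ℚ a + ℕ→ℚ b
ℕ→ℚ-+ a b = toℚᵘ-injective (begin
    toℚᵘ (ℕ→ℚ (a ℕ.+ b))              ≈⟨ toℚᵘ-fromℚᵘ (ℕ→ℚᵘ (a ℕ.+ b)) ⟩
    ℕ→ℚᵘ (a ℕ.+ b)                    ≈⟨ ℕ→ℚᵘ-+ a b ⟩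
    ℕ→ℚᵘ a ℚᵘ.+ ℕ→ℚᵘ b                ≈⟨ ℚᵘ.+-cong (toℚᵘ-fromℚᵘ (ℕ→ℚᵘ a)) (toℚᵘ-fromℚᵘ (ℕ→ℚᵘ b)) ⟨
    toℚᵘ (ℕ→ℚ a) ℚᵘ.+ toℚᵘ (ℕ→ℚ b)    ≈⟨ toℚᵘ-homo-+ (ℕ→ℚ a) (ℕ→ℚ b) ⟨
    toℚᵘ (ℕ→ℚ a + ℕ→ℚ b)              ∎)
  where open import Relation.Binary.Reasoning.Setoid ℚᵘ.≃-setoid

ℕ→ℚ-mono-≤ : ∀ {a b} → a ℕ.≤ b → ℕ→ℚ a ≤ ℕ→ℚ b
ℕ→ℚ-mono-≤ {a} {b} a≤b rewrite ℕ→ℚ≡mkℚ a | ℕ→ℚ≡mkℚ b =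
  *≤* (ℤ.*-monoʳ-≤-nonNeg (ℤ.+ 1) (ℤ.+≤+ a≤b))

sumℚ≡sum : ∀ {n} (f : Fin n → ℚ) → sumℚ f ≡ sum f
sumℚ≡sum {ℕ.zero}  f = refl
sumℚ≡sum {ℕ.suc n} f = cong (f Fin.zero +_) (sumℚ≡sum (f ∘ Fin.suc))

sum-mono-≤ : ∀ {n} {f g : Fin n → ℚ} → (∀ i → f i ≤ g i) → sum f ≤ sum g
sum-mono-≤ {ℕ.zero}  f≤g = ≤-refl
sum-mono-≤ {ℕ.suc n} f≤g = +-mono-≤ (f≤g Fin.zero) (sum-mono-≤ (f≤g ∘ Fin.suc))

sum-supported : ∀ {n} (a : Fin n) (f : Fin n → ℚ) → (∀ v → v ≢ a → f v ≡ 0ℚ) → sum f ≡ f a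
sum-supported {ℕ.suc n} a f vanish = begin
    sum f                                 ≡⟨ sum-remove {i = a} f ⟩
    f a + sum (λ i → f (punchIn a i))     ≡⟨ cong (f a +_) (sum-cong-≗ (λ i → vanish _ (punchInᵢ≢i a i))) ⟩
    f a + sum {n} (λ _ → 0ℚ)              ≡⟨ cong (f a +_) (sum-replicate-zero n) ⟩
    f a + 0ℚ                              ≡⟨ +-identityʳ (f a) ⟩
    f a                                   ∎
  where open ≡-Reasoning

module _ {n : ℕ} where

  δ : Fin n → Fin n → ℚ
  δ a v = if ⌊ v ≟ᶠ a ⌋ then 1ℚ else 0ℚ

  δ-diag : ∀ a → δ a a ≡ 1ℚ
  δ-diag a with a ≟ᶠ a
  ... | yes _ = refl
  ... | no a≢a = ⊥-elim (a≢a refl)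

  δ-off : ∀ {a v} → v ≢ a → δ a v ≡ 0ℚ
  δ-off {a} {v} v≢a with v ≟ᶠ a
  ... | yes v≡a = ⊥-elim (v≢a v≡a)
  ... | no _ = refl

  sum-*δ : ∀ (f : Fin n → ℚ) a → sum (λ v → f v * δ a v) ≡ f a
  sum-*δ f a = trans (sum-supported a _ (λ v v≢a → trans (cong (f v *_) (δ-off v≢a)) (*-zeroʳ (f v))))
                     (trans (cong (f a *_) (δ-diag a)) (*-identityʳ (f a)))

  δ-nonNeg : ∀ a v → 0ℚ ≤ δ a v
  δ-nonNeg a v with v ≟ᶠ a
  ... | yes _ = nonNegative⁻¹ 1ℚ
  ... | no _ = ≤-refl

  measure : List (Fin n × ℚ) → Fin n → ℚ
  measure [] v = 0ℚ
  measure ((a , c) ∷ ms) v = c * δ a v + measure ms v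

  plan : List (Fin n × Fin n × ℚ) → Fin n → Fin n → ℚ
  plan [] u v = 0ℚ
  plan ((a , b , c) ∷ ps) u v = c * (δ a u * δ b v) + plan ps u v

  source : List (Fin n × Fin n × ℚ) → List (Fin n × ℚ)
  source = map λ (a , b , c) → a , c

  target : List (Fin n × Fin n × ℚ) → List (Fin n × ℚ)
  target = map λ (a , b , c) → b , c

  planCost : (Fin n → Fin n → ℕ) → List (Fin n × Fin n × ℚ) → ℚ
  planCost d [] = 0ℚ
  planCost d ((a , b , c) ∷ ps) = ℕ→ℚ (d a b) * c + planCost d ps

  sum-plan-source : ∀ ps u → sum (plan ps u) ≡ measure (source ps) u
  sum-plan-source [] u = sum-replicate-zero n
  sum-plan-source ((a , b , c) ∷ ps) u = begin
      sum (λ v → c * (δ a u * δ b v) + plan ps u v)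
        ≡⟨ ∑-distrib-+ (λ v → c * (δ a u * δ b v)) (plan ps u) ⟩
      sum (λ v → c * (δ a u * δ b v)) + sum (plan ps u)
        ≡⟨ cong₂ _+_ (trans (sum-cong-≗ λ v → sym (*-assoc c (δ a u) (δ b v))) (sum-*δ (λ _ → c * δ a u) b))
                     (sum-plan-source ps u) ⟩
      c * δ a u + measure (source ps) u
        ∎
    where open ≡-Reasoning

  sum-plan-target : ∀ ps v → sum (λ u → plan ps u v) ≡ measure (target ps) v
  sum-plan-target [] v = sum-replicate-zero n
  sum-plan-target ((a , b , c) ∷ ps) v = begin
      sum (λ u → c * (δ a u * δ b v) + plan ps u v)
        ≡⟨ ∑-distrib-+ (λ u → c * (δ a u * δ b v)) (λ u → plan ps u v) ⟩
      sum (λ u → c * (δ a u * δ b v)) + sum (λ u → plan ps u v)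
        ≡⟨ cong₂ _+_ (trans (sum-cong-≗ λ u → swap c (δ a u) (δ b v)) (sum-*δ (λ _ → c * δ b v) a))
                     (sum-plan-target ps v) ⟩
      c * δ b v + measure (target ps) v
        ∎
    where
    open ≡-Reasoning
    swap : ∀ x y z → x * (y * z) ≡ (x * z) * y
    swap x y z = trans (cong (x *_) (*-comm y z)) (sym (*-assoc x z y))

  plan-nonNeg : ∀ ps → All (λ (_ , _ , c) → 0ℚ ≤ c) ps → ∀ u v → 0ℚ ≤ plan ps u v
  plan-nonNeg [] [] u v = ≤-refl
  plan-nonNeg ((a , b , c) ∷ ps) (0≤c ∷ 0≤ps) u v =
    +-mono-≤ (0≤* 0≤c (0≤* (δ-nonNeg a u) (δ-nonNeg b v))) (plan-nonNeg ps 0≤ps u v)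
    where
    0≤* : ∀ {p q} → 0ℚ ≤ p → 0ℚ ≤ q → 0ℚ ≤ p * q
    0≤* {p} {q} 0≤p 0≤q = subst (_≤ p * q) (*-zeroʳ p) (*-monoˡ-≤-nonNeg p {{nonNegative 0≤p}} 0≤q)

  plan-isCoupling : ∀ {m₁ m₂} ps → All (λ (_ , _ , c) → 0ℚ ≤ c) ps →
                    (∀ u → measure (source ps) u ≡ m₁ u) → (∀ v → measure (target ps) v ≡ m₂ v) →
                    IsCoupling m₁ m₂ (plan ps)
  plan-isCoupling ps 0≤ps src tgt =
      plan-nonNeg ps 0≤ps
    , (λ u → trans (sumℚ≡sum (plan ps u)) (trans (sum-plan-source ps u) (src u)))
    , (λ v → trans (sumℚ≡sum (λ u → plan ps u v)) (trans (sum-plan-target ps v) (tgt v)))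

  cost≡∑∑ : ∀ d (π : Fin n → Fin n → ℚ) → cost d π ≡ sum (λ u → sum (λ v → ℕ→ℚ (d u v) * π u v))
  cost≡∑∑ d π = trans (sumℚ≡sum {n} _) (sum-cong-≗ λ u → sumℚ≡sum {n} (λ v → ℕ→ℚ (d u v) * π u v))

  cost-plan : ∀ d ps → cost d (plan ps) ≡ planCost d ps
  cost-plan d ps = trans (cost≡∑∑ d (plan ps)) (∑∑-plan ps)
    where
    D : Fin n → Fin n → ℚ
    D u v = ℕ→ℚ (d u v)
    regroup : ∀ e c x y → e * (c * (x * y)) ≡ ((e * c) * x) * y
    regroup = solve 4 (λ e c x y → e :* (c :* (x :* y)) := ((e :* c) :* x) :* y) refl
    ∑∑-plan : ∀ ps → sum (λ u → sum (λ v → D u v * plan ps u v)) ≡ planCost d ps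
    ∑∑-plan [] = trans (sum-cong-≗ {n} λ u → trans (sum-cong-≗ {n} λ v → *-zeroʳ (D u v)) (sum-replicate-zero n))
                       (sum-replicate-zero n)
    ∑∑-plan ((a , b , c) ∷ ps) = begin
        sum (λ u → sum (λ v → D u v * (c * (δ a u * δ b v) + plan ps u v)))
          ≡⟨ sum-cong-≗ {n} (λ u → trans (sum-cong-≗ {n} (distribute u)) (∑-distrib-+ {n} _ _)) ⟩
        sum (λ u → sum (λ v → (D u v * c * δ a u) * δ b v) + sum (λ v → D u v * plan ps u v))
          ≡⟨ sum-cong-≗ {n} (λ u → cong (_+ sum (λ v → D u v * plan ps u v))
                                        (sum-*δ (λ v → D u v * c * δ a u) b)) ⟩
        sum (λ u → (D u b * c) * δ a u + sum (λ v → D u v * plan ps u v))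
          ≡⟨ ∑-distrib-+ {n} _ _ ⟩
        sum (λ u → (D u b * c) * δ a u) + sum (λ u → sum (λ v → D u v * plan ps u v))
          ≡⟨ cong₂ _+_ (sum-*δ (λ u → D u b * c) a) (∑∑-plan ps) ⟩
        D a b * c + planCost d ps
          ∎
      where
      open ≡-Reasoning
      distribute : ∀ u v → D u v * (c * (δ a u * δ b v) + plan ps u v)
                         ≡ (D u v * c * δ a u) * δ b v + D u v * plan ps u v
      distribute u v = trans (*-distribˡ-+ (D u v) _ _)
                             (cong (_+ D u v * plan ps u v) (regroup (D u v) c (δ a u) (δ b v)))

  integral : (Fin n → ℕ) → (Fin n → ℚ) → ℚ
  integral f m = sum (λ v → ℕ→ℚ (f v) * m v)

  atomIntegral : (Fin n → ℕ) → List (Fin n × ℚ) → ℚ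
  atomIntegral f [] = 0ℚ
  atomIntegral f ((a , c) ∷ ms) = ℕ→ℚ (f a) * c + atomIntegral f ms

  integral-measure : ∀ f ms → integral f (measure ms) ≡ atomIntegral f ms
  integral-measure f [] = trans (sum-cong-≗ {n} λ v → *-zeroʳ (ℕ→ℚ (f v))) (sum-replicate-zero n)
  integral-measure f ((a , c) ∷ ms) = begin
      sum (λ v → F v * (c * δ a v + measure ms v))
        ≡⟨ sum-cong-≗ {n} (λ v → trans (*-distribˡ-+ (F v) _ _)
                                       (cong (_+ F v * measure ms v) (sym (*-assoc (F v) c (δ a v))))) ⟩
      sum (λ v → F v * c * δ a v + F v * measure ms v)
        ≡⟨ ∑-distrib-+ {n} _ _ ⟩
      sum (λ v → F v * c * δ a v) + integral f (measure ms)
        ≡⟨ cong₂ _+_ (sum-*δ (λ v → F v * c) a) (integral-measure f ms) ⟩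
      F a * c + atomIntegral f ms
        ∎
    where
    open ≡-Reasoning
    F : Fin n → ℚ
    F = ℕ→ℚ ∘ f

integral-cong : ∀ {n} (f : Fin n → ℕ) {m m′ : Fin n → ℚ} → (∀ v → m v ≡ m′ v) → integral f m ≡ integral f m′
integral-cong f m≗m′ = sum-cong-≗ λ v → cong (ℕ→ℚ (f v) *_) (m≗m′ v)

weak-duality : ∀ {n} {d : Fin n → Fin n → ℕ} {f m₁ m₂ π} → Lipschitz d f → IsCoupling m₁ m₂ π →
               integral f m₁ ≤ cost d π + integral f m₂
weak-duality {n} {d} {f} {m₁} {m₂} {π} lip (0≤π , row , col) = begin
    sum (λ u → F u * m₁ u)
      ≡⟨ sum-cong-≗ {n} (λ u → cong (F u *_) (trans (sym (row u)) (sumℚ≡sum (π u)))) ⟩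
    sum (λ u → F u * sum (π u))
      ≡⟨ sum-cong-≗ {n} (λ u → *-distribˡ-sum (F u) (π u)) ⟩
    sum (λ u → sum (λ v → F u * π u v))
      ≤⟨ sum-mono-≤ (λ u → sum-mono-≤ (λ v → transport u v)) ⟩
    sum (λ u → sum (λ v → D u v * π u v + F v * π u v))
      ≡⟨ trans (sum-cong-≗ {n} (λ u → ∑-distrib-+ {n} _ _)) (∑-distrib-+ {n} _ _) ⟩
    sum (λ u → sum (λ v → D u v * π u v)) + sum (λ u → sum (λ v → F v * π u v))
      ≡⟨ cong₂ _+_ (sym (cost≡∑∑ d π)) (∑-comm {n} {n} _) ⟩
    cost d π + sum (λ v → sum (λ u → F v * π u v))
      ≡⟨ cong (cost d π +_) (sum-cong-≗ {n} λ v → sym (*-distribˡ-sum (F v) (λ u → π u v))) ⟩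
    cost d π + sum (λ v → F v * sum (λ u → π u v))
      ≡⟨ cong (cost d π +_) (sum-cong-≗ {n} λ v → cong (F v *_) (trans (sym (sumℚ≡sum {n} _)) (col v))) ⟩
    cost d π + integral f m₂
      ∎
  where
  open ≤-Reasoning
  F : Fin n → ℚ
  F = ℕ→ℚ ∘ f
  D : Fin n → Fin n → ℚ
  D u v = ℕ→ℚ (d u v)
  transport : ∀ u v → F u * π u v ≤ D u v * π u v + F v * π u v
  transport u v = begin
    F u * π u v                  ≤⟨ *-monoʳ-≤-nonNeg (π u v) {{nonNegative (0≤π u v)}} (ℕ→ℚ-mono-≤ (lip u v)) ⟩
    ℕ→ℚ (d u v ℕ.+ f v) * π u v  ≡⟨ cong (_* π u v) (ℕ→ℚ-+ (d u v) (f v)) ⟩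
    (D u v + F v) * π u v        ≡⟨ *-distribʳ-+ (π u v) (D u v) (F v) ⟩
    D u v * π u v + F v * π u v  ∎

+-cancelʳ-≤ : ∀ r {p q} → p + r ≤ q + r → p ≤ q
+-cancelʳ-≤ r {p} {q} p+r≤q+r = begin
    p              ≡⟨ [x+r]-r≡x p ⟨
    p + r - r      ≤⟨ +-monoˡ-≤ (- r) p+r≤q+r ⟩
    q + r - r      ≡⟨ [x+r]-r≡x q ⟩
    q              ∎
  where
  open ≤-Reasoning
  [x+r]-r≡x : ∀ x → x + r - r ≡ x
  [x+r]-r≡x x = trans (+-assoc x r (- r)) (trans (cong (x +_) (+-inverseʳ r)) (+-identityʳ x))

isW1-by-potential : ∀ {n} {d : Fin n → Fin n → ℕ} {f m₁ m₂ π} → IsCoupling m₁ m₂ π → Lipschitz d f →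
                    integral f m₁ ≡ cost d π + integral f m₂ → IsW1 d m₁ m₂ (cost d π)
isW1-by-potential {f = f} {m₂ = m₂} cpl lip balance =
  (_ , cpl , refl) , λ π′ cpl′ → +-cancelʳ-≤ (integral f m₂) (subst (_≤ _) balance (weak-duality lip cpl′))

*-/ₜ-cancelʳ : ∀ p q → q ≢ 0ℚ → (p * q) /ₜ q ≡ p
*-/ₜ-cancelʳ p q q≢0 with q ≟ 0ℚ
... | yes q≡0 = ⊥-elim (q≢0 q≡0)
... | no q≢0 = trans (*-assoc p q _) (trans (cong (p *_) (*-inverseʳ q {{≢-nonZero q≢0}})) (*-identityʳ p))

0/ₜ : ∀ q → 0ℚ /ₜ q ≡ 0ℚ
0/ₜ q with q ≟ 0ℚ
... | yes _ = refl
... | no q≢0 = *-zeroˡ ((1/ q) {{≢-nonZero q≢0}})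

hasCurvature-eventually-constant : ∀ {n} {G : Graph n} {d : Fin n → Fin n → ℕ} {x y κ} δ → 0ℚ < δ →
  (∀ α → 0ℚ ≤ α → 1ℚ - δ < α → α < 1ℚ →
     Σ ℚ λ w → IsW1 d (μ G α x) (μ G α y) w × κα w (d x y) /ₜ (1ℚ - α) ≡ κ) →
  HasCurvature G d x y κ
hasCurvature-eventually-constant {κ = κ} δ 0<δ exact ε 0<ε = δ , 0<δ , λ α 0≤α 1-δ<α α<1 →
  let (w , isW1 , κ≡) = exact α 0≤α 1-δ<α α<1 in
  w , isW1 , subst (λ r → ∣ r - κ ∣ < ε) (sym κ≡) (subst (_< ε) (sym (cong ∣_∣ (+-inverseʳ κ))) 0<ε)

module _ {n : ℕ} where

  uniform : ℚ → List (Fin n) → List (Fin n × ℚ)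
  uniform c = map (_, c)

  measure-uniform-outside : ∀ c {v} ys → All (v ≢_) ys → measure (uniform c ys) v ≡ 0ℚ
  measure-uniform-outside c [] [] = refl
  measure-uniform-outside c (y ∷ ys) (v≢y ∷ v∉ys) = begin
      c * δ y _ + measure (uniform c ys) _   ≡⟨ cong₂ _+_ (cong (c *_) (δ-off v≢y)) (measure-uniform-outside c ys v∉ys) ⟩
      c * 0ℚ + 0ℚ                            ≡⟨ trans (+-identityʳ _) (*-zeroʳ c) ⟩
      0ℚ                                     ∎
    where open ≡-Reasoning

  sum-measure-uniform-1 : ∀ ys → sum (measure (uniform 1ℚ ys)) ≡ ℕ→ℚ (length ys)
  sum-measure-uniform-1 [] = sum-replicate-zero n
  sum-measure-uniform-1 (y ∷ ys) = begin
      sum (λ v → 1ℚ * δ y v + measure (uniform 1ℚ ys) v)      ≡⟨ ∑-distrib-+ {n} _ _ ⟩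
      sum (λ v → 1ℚ * δ y v) + sum (measure (uniform 1ℚ ys))  ≡⟨ cong₂ _+_ (sum-*δ (λ _ → 1ℚ) y) (sum-measure-uniform-1 ys) ⟩
      1ℚ + ℕ→ℚ (length ys)                                    ≡⟨ ℕ→ℚ-+ 1 (length ys) ⟨
      ℕ→ℚ (suc (length ys))                                 ∎
    where open ≡-Reasoning

  indicator≡measure-uniform : ∀ {A : Set} (t : A → Fin n) c S → Unique (map t S) → ∀ v →
    (if any (λ s → ⌊ v ≟ᶠ t s ⌋) S then c else 0ℚ) ≡ measure (uniform c (map t S)) v
  indicator≡measure-uniform t c [] [] v = refl
  indicator≡measure-uniform t c (s ∷ S) (ts∉S ∷ uniq) v with v ≟ᶠ t s
  ... | yes refl = begin
      c                                          ≡⟨ trans (+-identityʳ (c * 1ℚ)) (*-identityʳ c) ⟨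
      c * 1ℚ + 0ℚ                                ≡⟨ cong (c * 1ℚ +_) (measure-uniform-outside c (map t S) ts∉S) ⟨
      c * 1ℚ + measure (uniform c (map t S)) (t s)  ∎
    where open ≡-Reasoning
  ... | no v≢ts = begin
      (if any (λ s → ⌊ v ≟ᶠ t s ⌋) S then c else 0ℚ)  ≡⟨ indicator≡measure-uniform t c S uniq v ⟩
      measure (uniform c (map t S)) v                 ≡⟨ +-identityˡ _ ⟨
      0ℚ + measure (uniform c (map t S)) v            ≡⟨ cong (_+ measure (uniform c (map t S)) v) (*-zeroʳ c) ⟨
      c * 0ℚ + measure (uniform c (map t S)) v        ∎
    where open ≡-Reasoning

ℕ→ℚ-sumℕ : ∀ {n} (f : Fin n → ℕ) → ℕ→ℚ (sumℕ f) ≡ sum (ℕ→ℚ ∘ f)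
ℕ→ℚ-sumℕ {zero} f = refl
ℕ→ℚ-sumℕ {suc n} f = trans (ℕ→ℚ-+ (f Fin.zero) _) (cong (ℕ→ℚ (f Fin.zero) +_) (ℕ→ℚ-sumℕ (f ∘ Fin.suc)))

module _ {n : ℕ} (S : List ℕ) (x : Fin n) where

  deg-cayley : Unique (map (x ⊕_) S) → ℕ→ℚ (deg (Cayley n S) x) ≡ ℕ→ℚ (length S)
  deg-cayley uniq = begin
      ℕ→ℚ (deg (Cayley n S) x)                              ≡⟨ ℕ→ℚ-sumℕ {n} _ ⟩
      sum (λ v → ℕ→ℚ (if Cayley n S x v then 1 else 0))     ≡⟨ sum-cong-≗ {n} (λ v → ℕ→ℚ-if (Cayley n S x v)) ⟩
      sum (λ v → if Cayley n S x v then 1ℚ else 0ℚ)         ≡⟨ sum-cong-≗ {n} (indicator≡measure-uniform (x ⊕_) 1ℚ S uniq) ⟩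
      sum (measure (uniform 1ℚ (map (x ⊕_) S)))            ≡⟨ sum-measure-uniform-1 (map (x ⊕_) S) ⟩
      ℕ→ℚ (length (map (x ⊕_) S))                          ≡⟨ cong ℕ→ℚ (length-map (x ⊕_) S) ⟩
      ℕ→ℚ (length S)                                        ∎
    where
    open ≡-Reasoning
    ℕ→ℚ-if : ∀ b → ℕ→ℚ (if b then 1 else 0) ≡ (if b then 1ℚ else 0ℚ)
    ℕ→ℚ-if true = refl
    ℕ→ℚ-if false = refl

  neighbourWeight : ℚ → ℚ
  neighbourWeight α = (1ℚ - α) /ₜ ℕ→ℚ (deg (Cayley n S) x)

  μ-cayley : Unique (x ∷ map (x ⊕_) S) → ∀ α v →
    μ (Cayley n S) α x v ≡ measure ((x , α) ∷ uniform (neighbourWeight α) (map (x ⊕_) S)) v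
  μ-cayley (x∉S ∷ uniq) α v with v ≟ᶠ x
  ... | yes refl = begin
      α                                  ≡⟨ trans (+-identityʳ (α * 1ℚ)) (*-identityʳ α) ⟨
      α * 1ℚ + 0ℚ                        ≡⟨ cong (α * 1ℚ +_) (measure-uniform-outside w (map (x ⊕_) S) x∉S) ⟨
      α * 1ℚ + measure (uniform w (map (x ⊕_) S)) x  ∎
    where
    open ≡-Reasoning
    w : ℚ
    w = neighbourWeight α
  ... | no v≢x = begin
      (if Cayley n S x v then w else 0ℚ)          ≡⟨ indicator≡measure-uniform (x ⊕_) w S uniq v ⟩
      measure (uniform w (map (x ⊕_) S)) v        ≡⟨ +-identityˡ _ ⟨
      0ℚ + measure (uniform w (map (x ⊕_) S)) v   ≡⟨ cong (_+ measure (uniform w (map (x ⊕_) S)) v) (*-zeroʳ α) ⟨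
      α * 0ℚ + measure (uniform w (map (x ⊕_) S)) v  ∎
    where
    open ≡-Reasoning
    w : ℚ
    w = neighbourWeight α

-- Facts about indices are decided by evaluation: lemmas take them as implicit arguments of type
-- True (p? …), which Agda fills in by itself when the indices are numerals (as for Data.Fin.#_).
neighbourIndices : ℕ → List ℕ
neighbourIndices a = a ℕ.+ 1 ∷ a ℕ.∸ 1 ∷ a ℕ.+ 4 ∷ a ℕ.∸ 4 ∷ []

Interior : ℕ → Set
Interior a = 4 ℕ.≤ a × All (ℕ._< 23) (a ∷ neighbourIndices a) × Unique (a ∷ neighbourIndices a)

interior? : ∀ a → Dec (Interior a)
interior? a = 4 ℕ.≤? a ×-dec all? (ℕ._<? 23) (a ∷ neighbourIndices a) ×-dec unique? (a ∷ neighbourIndices a)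

Distinct : ℕ → ℕ → Set
Distinct a c = a ℕ.< 23 × c ℕ.< 23 × a ≢ c

distinct? : ∀ a c → Dec (Distinct a c)
distinct? a c = a ℕ.<? 23 ×-dec c ℕ.<? 23 ×-dec ¬? (a ℕ.≟ c)

Edge : ℕ → ℕ → Set
Edge a c = 4 ℕ.≤ a × c ∈ neighbourIndices a

edge? : ∀ a c → Dec (Edge a c)
edge? a c = 4 ℕ.≤? a ×-dec c ∈? neighbourIndices a

Separated : ℕ → ℕ → Set
Separated a c = Interior a × c ℕ.< 23 × c ∉ neighbourIndices a

separated? : ∀ a c → Dec (Separated a c)
separated? a c = interior? a ×-dec c ℕ.<? 23 ×-dec c ∉? neighbourIndices a

FarApart : ℕ → ℕ → Set
FarApart a c = 4 ℕ.≤ a × All (λ k → Separated k c) (neighbourIndices a)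

farApart? : ∀ a c → Dec (FarApart a c)
farApart? a c = 4 ℕ.≤? a ×-dec all? (λ k → separated? k c) (neighbourIndices a)

β : ℚ → ℚ
β α = (1ℚ - α) /ₜ ℕ→ℚ 4

module LocalCoordinates {m : ℕ} (22≤m : 22 ℕ.≤ m) (g : Fin (suc m)) where

  N : ℕ
  N = suc m

  G : Graph N
  G = Cayley N (S₁₄ N)

  base : Fin N
  base = g ⊕ (N ℕ.∸ 12)

  -- V k is the vertex g + (k − 12); the indices used below lie in [0, 22].
  V : ℕ → Fin N
  V k = base ⊕ k

  private
    <23⇒<N : ∀ {k} → k ℕ.< 23 → k ℕ.< N
    <23⇒<N k<23 = ℕ.≤-trans k<23 (s≤s 22≤m)

    12<N : 12 ℕ.< N
    12<N = <23⇒<N (ℕ.<ᵇ⇒< 12 23 _)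

  V-+ : ∀ k s → V k ⊕ s ≡ V (k ℕ.+ s)
  V-+ k s = ⊕-assoc base k s

  V-∸ : ∀ k s → s ℕ.≤ k → s ℕ.< 23 → V k ⊕ (N ℕ.∸ s) ≡ V (k ℕ.∸ s)
  V-∸ k s s≤k s<23 = begin
      V k ⊕ (N ℕ.∸ s)            ≡⟨ ⊕-assoc base k (N ℕ.∸ s) ⟩
      base ⊕ (k ℕ.+ (N ℕ.∸ s))     ≡⟨ cong (base ⊕_) k+[N∸s]≡[k∸s]+N ⟩
      base ⊕ (k ℕ.∸ s ℕ.+ N)       ≡⟨ ⊕-periodic base (k ℕ.∸ s) ⟩
      V (k ℕ.∸ s)                ∎
    where
    open ≡-Reasoning
    k+[N∸s]≡[k∸s]+N : k ℕ.+ (N ℕ.∸ s) ≡ k ℕ.∸ s ℕ.+ N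
    k+[N∸s]≡[k∸s]+N = begin
      k ℕ.+ (N ℕ.∸ s)            ≡⟨ cong (ℕ._+ (N ℕ.∸ s)) (ℕ.m∸n+n≡m s≤k) ⟨
      k ℕ.∸ s ℕ.+ s ℕ.+ (N ℕ.∸ s)    ≡⟨ ℕ.+-assoc (k ℕ.∸ s) s (N ℕ.∸ s) ⟩
      k ℕ.∸ s ℕ.+ (s ℕ.+ (N ℕ.∸ s))  ≡⟨ cong (k ℕ.∸ s ℕ.+_) (ℕ.m+[n∸m]≡n (ℕ.<⇒≤ (<23⇒<N s<23))) ⟩
      k ℕ.∸ s ℕ.+ N              ∎

  g≡V12 : g ≡ V 12
  g≡V12 = sym (begin
      V 12                  ≡⟨ ⊕-assoc g (N ℕ.∸ 12) 12 ⟩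
      g ⊕ (N ℕ.∸ 12 ℕ.+ 12)     ≡⟨ cong (g ⊕_) (ℕ.m∸n+n≡m (ℕ.<⇒≤ 12<N)) ⟩
      g ⊕ N                 ≡⟨ ⊕-periodic g 0 ⟩
      g ⊕ 0                 ≡⟨ ⊕-identityʳ g ⟩
      g                     ∎)
    where open ≡-Reasoning

  V-injective : ∀ {a c} → a ℕ.< 23 → c ℕ.< 23 → V a ≡ V c → a ≡ c
  V-injective a<23 c<23 = ⊕-cancelˡ base (<23⇒<N a<23) (<23⇒<N c<23)

  V-∉ : ∀ {k ks} → k ℕ.< 23 → All (ℕ._< 23) ks → k ∉ ks → V k ∉ map V ks
  V-∉ k<23 (j<23 ∷ _) k∉ (here Vk≡Vj) = k∉ (here (V-injective k<23 j<23 Vk≡Vj))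
  V-∉ k<23 (_ ∷ js<23) k∉ (there Vk∈) = V-∉ k<23 js<23 (k∉ ∘ there) Vk∈

  V-unique : ∀ {ks} → All (ℕ._< 23) ks → Unique ks → Unique (map V ks)
  V-unique [] [] = []
  V-unique (k<23 ∷ ks<23) (k∉ks ∷ uniq) =
    ¬Any⇒All¬ _ (V-∉ k<23 ks<23 (All¬⇒¬Any k∉ks)) ∷ V-unique ks<23 uniq

  V-distinct : ∀ a c {_ : True (distinct? a c)} → V a ≢ V c
  V-distinct a c {p} = let (a<23 , c<23 , a≢c) = toWitness p in a≢c ∘ V-injective a<23 c<23

  neighbours-V : ∀ {a} → 4 ℕ.≤ a → map (V a ⊕_) (S₁₄ N) ≡ map V (neighbourIndices a)
  neighbours-V {a} 4≤a =
    cong₂ _∷_ (V-+ a 1) (cong₂ _∷_ (V-∸ a 1 (ℕ.≤-trans (s≤s z≤n) 4≤a) (ℕ.<ᵇ⇒< 1 23 _))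
      (cong₂ _∷_ (V-+ a 4) (cong₂ _∷_ (V-∸ a 4 4≤a (ℕ.<ᵇ⇒< 4 23 _)) refl)))

  adjacent⇔ : ∀ {a y} → 4 ℕ.≤ a → T (G (V a) y) ⇔ y ∈ map V (neighbourIndices a)
  adjacent⇔ {a} {y} 4≤a =
    subst (λ ys → T (G (V a) y) ⇔ y ∈ ys) (neighbours-V 4≤a) (cayley-adjacent⇔ (S₁₄ N) {V a} {y})

  edge : ∀ a k {_ : True (edge? a k)} → T (G (V a) (V k))
  edge a k {p} = let (4≤a , k∈) = toWitness p in
    Equivalence.from (adjacent⇔ {a} {V k} 4≤a) (Any-map⁺ (Any.map (cong V) k∈))

  hop : ∀ a k {_ : True (edge? a k)} {y ℓ} → Walk G (V k) y ℓ → Walk G (V a) y (suc ℓ)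
  hop a k {e} = step {z = V k} (edge a k {e})

  private
    nonadjacent′ : ∀ {a c} → Separated a c → ¬ T (G (V a) (V c))
    nonadjacent′ {a} {c} ((4≤a , _ ∷ nbrs<23 , _) , c<23 , c∉) e =
      V-∉ c<23 nbrs<23 c∉ (Equivalence.to (adjacent⇔ {a} {V c} 4≤a) e)

  nonadjacent : ∀ a c {_ : True (separated? a c)} → ¬ T (G (V a) (V c))
  nonadjacent a c {p} = nonadjacent′ (toWitness p)

  noCommonNeighbour : ∀ a c {_ : True (farApart? a c)} → ∀ z → T (G (V a) z) → ¬ T (G z (V c))
  noCommonNeighbour a c {p} z e =
    let (4≤a , separated) = toWitness p
        z∈nbrs = Any-map⁻ {f = V} (Equivalence.to (adjacent⇔ {a} {z} 4≤a) e)
        (separatedₖ , z≡Vk) = All.lookupAny separated z∈nbrs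
    in subst (λ w → ¬ T (G w (V c))) (sym z≡Vk) (nonadjacent′ separatedₖ)

  μV : ℚ → ℕ → List (Fin N × ℚ)
  μV α a = (V a , α) ∷ uniform (β α) (map V (neighbourIndices a))

  μ-local : ∀ a {_ : True (interior? a)} α v → μ G α (V a) v ≡ measure (μV α a) v
  μ-local a {p} α v = begin
      μ G α (V a) v
        ≡⟨ μ-cayley (S₁₄ N) (V a) unique α v ⟩
      measure ((V a , α) ∷ uniform (neighbourWeight (S₁₄ N) (V a) α) (map (V a ⊕_) (S₁₄ N))) v
        ≡⟨ cong₂ (λ w ys → measure ((V a , α) ∷ uniform w ys) v)
                 (cong ((1ℚ - α) /ₜ_) (deg-cayley (S₁₄ N) (V a) (AllPairs.tail unique))) (neighbours-V 4≤a) ⟩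
      measure (μV α a) v ∎
    where
    open ≡-Reasoning
    4≤a : 4 ℕ.≤ a
    4≤a = proj₁ (toWitness p)
    unique : Unique (V a ∷ map (V a ⊕_) (S₁₄ N))
    unique = let (_ , bounds , distinct) = toWitness p in
      subst (Unique ∘ (V a ∷_)) (sym (neighbours-V 4≤a)) (V-unique bounds distinct)

  module Distances {d : Fin N → Fin N → ℕ} (isDist : IsGraphDistance G d) where
    open GraphDistance isDist public

    1≤d-local : ∀ a c {_ : True (distinct? a c)} → 1 ℕ.≤ d (V a) (V c)
    1≤d-local a c {p} = 1≤d (V-distinct a c {p})

    2≤d-local : ∀ a c {_ : True (distinct? a c)} {_ : True (separated? a c)} → 2 ℕ.≤ d (V a) (V c)
    2≤d-local a c {p} {q} = 2≤d (V-distinct a c {p}) (nonadjacent a c {q})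

    d-edge : ∀ a c {_ : True (edge? a c)} {_ : True (distinct? a c)} → d (V a) (V c) ≡ 1
    d-edge a c {e} {p} = ℕ.≤-antisym (d≤1 (edge a c {e})) (1≤d-local a c {p})

    d-two : ∀ a c {_ : True (distinct? a c)} {_ : True (separated? a c)} →
            Walk G (V a) (V c) 2 → d (V a) (V c) ≡ 2
    d-two a c {p} {q} w = ℕ.≤-antisym (d≤walk w) (2≤d-local a c {p} {q})

    d-three : ∀ a c {_ : True (distinct? a c)} {_ : True (separated? a c)} {_ : True (farApart? a c)} →
              Walk G (V a) (V c) 3 → d (V a) (V c) ≡ 3
    d-three a c {p} {q} {r} w =
      ℕ.≤-antisym (d≤walk w) (3≤d (V-distinct a c {p}) (nonadjacent a c {q}) (noCommonNeighbour a c {r}))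

    isW1-local : ∀ α a c {_ : True (interior? a)} {_ : True (interior? c)} ps f →
      All (λ (_ , _ , w) → 0ℚ ≤ w) ps →
      (∀ u → measure (source ps) u ≡ measure (μV α a) u) →
      (∀ u → measure (target ps) u ≡ measure (μV α c) u) →
      Lipschitz d f → atomIntegral f (μV α a) ≡ planCost d ps + atomIntegral f (μV α c) →
      IsW1 d (μ G α (V a)) (μ G α (V c)) (planCost d ps)
    isW1-local α a c {p} {q} ps f 0≤ps src tgt lip balance =
      subst (IsW1 d (μ G α (V a)) (μ G α (V c))) (cost-plan d ps)
        (isW1-by-potential coupling lip (begin
          integral f (μ G α (V a))                          ≡⟨ integral-μ a {p} ⟩
          atomIntegral f (μV α a)                           ≡⟨ balance ⟩
          planCost d ps + atomIntegral f (μV α c)         ≡⟨ cong₂ _+_ (cost-plan d ps) (integral-μ c {q}) ⟨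
          cost d (plan ps) + integral f (μ G α (V c))     ∎))
      where
      open ≡-Reasoning
      coupling : IsCoupling (μ G α (V a)) (μ G α (V c)) (plan ps)
      coupling = plan-isCoupling ps 0≤ps (λ u → trans (src u) (sym (μ-local a {p} α u)))
                                          (λ u → trans (tgt u) (sym (μ-local c {q} α u)))
      integral-μ : ∀ b {_ : True (interior? b)} → integral f (μ G α (V b)) ≡ atomIntegral f (μV α b)
      integral-μ b {r} = trans (integral-cong f (μ-local b {r} α)) (integral-measure f (μV α b))

weightedSum : List ℕ → List ℚ → ℚ
weightedSum (k ∷ ks) (c ∷ cs) = ℕ→ℚ k * c + weightedSum ks cs
weightedSum _        _        = 0ℚ

module _ {n : ℕ} where

  planCost-values : ∀ {d : Fin n → Fin n → ℕ} {ps ks} → Pointwise (λ (a , b , _) k → d a b ≡ k) ps ks →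
                    planCost d ps ≡ weightedSum ks (map (proj₂ ∘ proj₂) ps)
  planCost-values [] = refl
  planCost-values {ps = (_ , _ , c) ∷ _} (d≡k ∷ ds) = cong₂ _+_ (cong (λ k → ℕ→ℚ k * c) d≡k) (planCost-values ds)

  atomIntegral-values : ∀ {f : Fin n → ℕ} {ms ks} → Pointwise (λ (a , _) k → f a ≡ k) ms ks →
                        atomIntegral f ms ≡ weightedSum ks (map proj₂ ms)
  atomIntegral-values [] = refl
  atomIntegral-values {ms = (_ , c) ∷ _} (f≡k ∷ fs) = cong₂ _+_ (cong (λ k → ℕ→ℚ k * c) f≡k) (atomIntegral-values fs)

weightedSumP : ∀ {k} → List ℕ → List (Polynomial k) → Polynomial k
weightedSumP (j ∷ js) (e ∷ es) = con (ℕ→ℚ j) :* e :+ weightedSumP js es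
weightedSumP _        _        = con 0ℚ

βP : Polynomial 1 → Polynomial 1
βP a = (con 1ℚ :- a) :* con (ℤ.+ 1 / 4)

p≤q⇒0≤q-p : ∀ {p q} → p ≤ q → 0ℚ ≤ q - p
p≤q⇒0≤q-p {p} {q} p≤q = subst (_≤ q - p) (+-inverseʳ p) (+-monoˡ-≤ (- p) p≤q)

0≤β : ∀ α → α < 1ℚ → 0ℚ ≤ β α
0≤β α α<1 = subst (_≤ β α) (*-zeroˡ (ℤ.+ 1 / 4)) (*-monoʳ-≤-nonNeg (ℤ.+ 1 / 4) (p≤q⇒0≤q-p (<⇒≤ α<1)))

0≤α-β : ∀ α → 1ℚ - ℤ.+ 1 / 2 < α → 0ℚ ≤ α - β α
0≤α-β α ½<α = subst (0ℚ ≤_) (sym rearranged) (+-mono-≤ 0≤excess (nonNegative⁻¹ (ℤ.+ 3 / 8)))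
  where
  0≤excess : 0ℚ ≤ (α - (1ℚ - ℤ.+ 1 / 2)) * (ℤ.+ 5 / 4)
  0≤excess = subst (_≤ (α - (1ℚ - ℤ.+ 1 / 2)) * (ℤ.+ 5 / 4)) (*-zeroˡ (ℤ.+ 5 / 4)) (*-monoʳ-≤-nonNeg (ℤ.+ 5 / 4) (p≤q⇒0≤q-p (<⇒≤ ½<α)))
  rearranged : α - β α ≡ (α - (1ℚ - ℤ.+ 1 / 2)) * (ℤ.+ 5 / 4) + ℤ.+ 3 / 8
  rearranged = solve 1 (λ a → a :- βP a := (a :- (con 1ℚ :- con (ℤ.+ 1 / 2))) :* con (ℤ.+ 5 / 4) :+ con (ℤ.+ 3 / 8))
                       refl α

1-α≢0 : ∀ {α} → α < 1ℚ → 1ℚ - α ≢ 0ℚ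
1-α≢0 {α} α<1 1-α≡0 = <-irrefl (sym (x∙y⁻¹≈ε⇒x≈y 1ℚ α 1-α≡0)) α<1

localWeights : ℚ → List ℚ
localWeights α = α ∷ β α ∷ β α ∷ β α ∷ β α ∷ []

localWeightsP : Polynomial 1 → List (Polynomial 1)
localWeightsP a = a ∷ βP a ∷ βP a ∷ βP a ∷ βP a ∷ []

module EdgeB {m : ℕ} (22≤m : 22 ℕ.≤ m) (g : Fin (suc m))
             {d : Fin (suc m) → Fin (suc m) → ℕ} (isDist : IsGraphDistance (Cayley (suc m) (S₁₄ (suc m))) d) where
  open LocalCoordinates 22≤m g
  open Distances isDist

  planB : ℚ → List (Fin N × Fin N × ℚ)
  planB α = (V 12 , V 16 , α) ∷ (V 13 , V 17 , β α) ∷ (V 11 , V 15 , β α)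
          ∷ (V 16 , V 20 , β α) ∷ (V 8 , V 12 , β α) ∷ []

  cost-planB : ∀ α → planCost d (planB α) ≡ 1ℚ
  cost-planB α = begin
      planCost d (planB α)
        ≡⟨ planCost-values {d = d} {ps = planB α}
             (d-edge 12 16 ∷ d-edge 13 17 ∷ d-edge 11 15 ∷ d-edge 16 20 ∷ d-edge 8 12 ∷ []) ⟩
      weightedSum (1 ∷ 1 ∷ 1 ∷ 1 ∷ 1 ∷ []) (localWeights α)
        ≡⟨ solve 1 (λ a → weightedSumP (1 ∷ 1 ∷ 1 ∷ 1 ∷ 1 ∷ []) (localWeightsP a) := con 1ℚ) refl α ⟩
      1ℚ ∎
    where open ≡-Reasoning

  fB : Fin N → ℕ
  fB v = d v (V 20)

  balanceB : ∀ α → atomIntegral fB (μV α 12) ≡ planCost d (planB α) + atomIntegral fB (μV α 16)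
  balanceB α = begin
      atomIntegral fB (μV α 12)
        ≡⟨ atomIntegral-values {f = fB} {ms = μV α 12}
             (d-two 12 20 (hop 12 16 (hop 16 20 here))
            ∷ d-three 13 20 (hop 13 17 (hop 17 16 (hop 16 20 here)))
            ∷ d-three 11 20 (hop 11 15 (hop 15 16 (hop 16 20 here)))
            ∷ d-edge 16 20
            ∷ d-three 8 20 (hop 8 12 (hop 12 16 (hop 16 20 here)))
            ∷ []) ⟩
      weightedSum (2 ∷ 3 ∷ 3 ∷ 1 ∷ 3 ∷ []) (localWeights α)
        ≡⟨ solve 1 (λ a → weightedSumP (2 ∷ 3 ∷ 3 ∷ 1 ∷ 3 ∷ []) (localWeightsP a)
                      := con 1ℚ :+ weightedSumP (1 ∷ 2 ∷ 2 ∷ 0 ∷ 2 ∷ []) (localWeightsP a)) refl α ⟩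
      1ℚ + weightedSum (1 ∷ 2 ∷ 2 ∷ 0 ∷ 2 ∷ []) (localWeights α)
        ≡⟨ cong₂ _+_ (cost-planB α) (atomIntegral-values {f = fB} {ms = μV α 16}
             (d-edge 16 20
            ∷ d-two 17 20 (hop 17 16 (hop 16 20 here))
            ∷ d-two 15 20 (hop 15 16 (hop 16 20 here))
            ∷ d-refl (V 20)
            ∷ d-two 12 20 (hop 12 16 (hop 16 20 here))
            ∷ [])) ⟨
      planCost d (planB α) + atomIntegral fB (μV α 16) ∎
    where open ≡-Reasoning

  curvatureB : HasCurvature G d (V 12) (V 16) 0ℚ
  curvatureB = hasCurvature-eventually-constant {G = G} {d = d} (ℤ.+ 1 / 2) (positive⁻¹ (ℤ.+ 1 / 2)) λ α 0≤α _ α<1 →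
      planCost d (planB α)
    , isW1-local α 12 16 (planB α) fB (0≤α ∷ 0≤β α α<1 ∷ 0≤β α α<1 ∷ 0≤β α α<1 ∷ 0≤β α α<1 ∷ [])
                 (λ _ → refl) (λ _ → refl) (d-Lipschitz (V 20)) (balanceB α)
    , (begin
        κα (planCost d (planB α)) (d (V 12) (V 16)) /ₜ (1ℚ - α)  ≡⟨ cong₂ (λ w k → κα w k /ₜ (1ℚ - α)) (cost-planB α) (d-edge 12 16) ⟩
        κα 1ℚ 1 /ₜ (1ℚ - α)                                      ≡⟨ 0/ₜ (1ℚ - α) ⟩
        0ℚ                                                       ∎)
    where open ≡-Reasoning

module EdgeA {m : ℕ} (22≤m : 22 ℕ.≤ m) (g : Fin (suc m))
             {d : Fin (suc m) → Fin (suc m) → ℕ} (isDist : IsGraphDistance (Cayley (suc m) (S₁₄ (suc m))) d) where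
  open LocalCoordinates 22≤m g
  open Distances isDist

  planA : ℚ → List (Fin N × Fin N × ℚ)
  planA α = (V 12 , V 12 , β α) ∷ (V 12 , V 13 , α - β α) ∷ (V 13 , V 13 , β α)
          ∷ (V 11 , V 14 , β α) ∷ (V 16 , V 17 , β α) ∷ (V 8 , V 9 , β α) ∷ []

  source-planA : ∀ α u → measure (source (planA α)) u ≡ measure (μV α 12) u
  source-planA α u = solve 7 (λ a b δ₁₂ δ₁₃ δ₁₁ δ₁₆ δ₈ →
      b :* δ₁₂ :+ ((a :- b) :* δ₁₂ :+ (b :* δ₁₃ :+ (b :* δ₁₁ :+ (b :* δ₁₆ :+ (b :* δ₈ :+ con 0ℚ)))))
        := a :* δ₁₂ :+ (b :* δ₁₃ :+ (b :* δ₁₁ :+ (b :* δ₁₆ :+ (b :* δ₈ :+ con 0ℚ))))) refl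
    α (β α) (δ (V 12) u) (δ (V 13) u) (δ (V 11) u) (δ (V 16) u) (δ (V 8) u)

  target-planA : ∀ α u → measure (target (planA α)) u ≡ measure (μV α 13) u
  target-planA α u = solve 7 (λ a b δ₁₂ δ₁₃ δ₁₄ δ₁₇ δ₉ →
      b :* δ₁₂ :+ ((a :- b) :* δ₁₃ :+ (b :* δ₁₃ :+ (b :* δ₁₄ :+ (b :* δ₁₇ :+ (b :* δ₉ :+ con 0ℚ)))))
        := a :* δ₁₃ :+ (b :* δ₁₄ :+ (b :* δ₁₂ :+ (b :* δ₁₇ :+ (b :* δ₉ :+ con 0ℚ))))) refl
    α (β α) (δ (V 12) u) (δ (V 13) u) (δ (V 14) u) (δ (V 17) u) (δ (V 9) u)

  fA : Fin N → ℕ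
  fA v = d v (V 9) ℕ.⊓ (d v (V 13) ℕ.⊓ d v (V 14))

  fA-Lipschitz : Lipschitz d fA
  fA-Lipschitz = ⊓-Lipschitz (d-Lipschitz (V 9)) (⊓-Lipschitz (d-Lipschitz (V 13)) (d-Lipschitz (V 14)))

  fA≡ : ∀ {v} k → k ℕ.≤ d v (V 9) → k ℕ.≤ d v (V 13) → k ℕ.≤ d v (V 14) →
        d v (V 9) ℕ.≤ k ⊎ d v (V 13) ℕ.≤ k ⊎ d v (V 14) ℕ.≤ k → fA v ≡ k
  fA≡ k k≤d₉ k≤d₁₃ k≤d₁₄ attained = ℕ.≤-antisym (upper attained) (ℕ.⊓-glb k≤d₉ (ℕ.⊓-glb k≤d₁₃ k≤d₁₄))
    where
    upper : _ ⊎ _ ⊎ _ → fA _ ℕ.≤ k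
    upper (inj₁ d₉≤k)        = ℕ.≤-trans (ℕ.m⊓n≤m _ _) d₉≤k
    upper (inj₂ (inj₁ d₁₃≤k)) = ℕ.≤-trans (ℕ.m⊓n≤n _ _) (ℕ.≤-trans (ℕ.m⊓n≤m _ _) d₁₃≤k)
    upper (inj₂ (inj₂ d₁₄≤k)) = ℕ.≤-trans (ℕ.m⊓n≤n _ _) (ℕ.≤-trans (ℕ.m⊓n≤n _ _) d₁₄≤k)

  fA-zero : ∀ {v} → d v (V 9) ≡ 0 ⊎ d v (V 13) ≡ 0 ⊎ d v (V 14) ≡ 0 → fA v ≡ 0
  fA-zero vanishes =
    fA≡ 0 z≤n z≤n z≤n (Sum.map ℕ.≤-reflexive (Sum.map ℕ.≤-reflexive ℕ.≤-reflexive) vanishes)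

  cost-planA : ∀ α → planCost d (planA α) ≡ α + ℕ→ℚ 3 * β α
  cost-planA α = begin
      planCost d (planA α)
        ≡⟨ planCost-values {d = d} {ps = planA α}
             (d-refl (V 12) ∷ d-edge 12 13 ∷ d-refl (V 13) ∷ d-two 11 14 (hop 11 15 (hop 15 14 here))
            ∷ d-edge 16 17 ∷ d-edge 8 9 ∷ []) ⟩
      weightedSum (0 ∷ 1 ∷ 0 ∷ 2 ∷ 1 ∷ 1 ∷ []) (β α ∷ α - β α ∷ β α ∷ β α ∷ β α ∷ β α ∷ [])
        ≡⟨ solve 1 (λ a → weightedSumP (0 ∷ 1 ∷ 0 ∷ 2 ∷ 1 ∷ 1 ∷ []) (βP a ∷ a :- βP a ∷ βP a ∷ βP a ∷ βP a ∷ βP a ∷ [])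
                      := a :+ con (ℕ→ℚ 3) :* βP a) refl α ⟩
      α + ℕ→ℚ 3 * β α ∎
    where open ≡-Reasoning

  balanceA : ∀ α → atomIntegral fA (μV α 12) ≡ planCost d (planA α) + atomIntegral fA (μV α 13)
  balanceA α = begin
      atomIntegral fA (μV α 12)
        ≡⟨ atomIntegral-values {f = fA} {ms = μV α 12}
             (fA≡ 1 (1≤d-local 12 9) (1≤d-local 12 13) (1≤d-local 12 14) (inj₂ (inj₁ (d≤1 (edge 12 13))))
            ∷ fA-zero (inj₂ (inj₁ (d-refl (V 13))))
            ∷ fA≡ 2 (2≤d-local 11 9) (2≤d-local 11 13) (2≤d-local 11 14) (inj₁ (d≤walk (hop 11 10 (hop 10 9 here))))
            ∷ fA≡ 2 (2≤d-local 16 9) (2≤d-local 16 13) (2≤d-local 16 14) (inj₂ (inj₂ (d≤walk (hop 16 15 (hop 15 14 here)))))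
            ∷ fA≡ 1 (1≤d-local 8 9) (1≤d-local 8 13) (1≤d-local 8 14) (inj₁ (d≤1 (edge 8 9)))
            ∷ []) ⟩
      weightedSum (1 ∷ 0 ∷ 2 ∷ 2 ∷ 1 ∷ []) (localWeights α)
        ≡⟨ solve 1 (λ a → weightedSumP (1 ∷ 0 ∷ 2 ∷ 2 ∷ 1 ∷ []) (localWeightsP a)
                      := (a :+ con (ℕ→ℚ 3) :* βP a) :+ weightedSumP (0 ∷ 0 ∷ 1 ∷ 1 ∷ 0 ∷ []) (localWeightsP a)) refl α ⟩
      (α + ℕ→ℚ 3 * β α) + weightedSum (0 ∷ 0 ∷ 1 ∷ 1 ∷ 0 ∷ []) (localWeights α)
        ≡⟨ cong₂ _+_ (cost-planA α) (atomIntegral-values {f = fA} {ms = μV α 13}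
             (fA-zero (inj₂ (inj₁ (d-refl (V 13))))
            ∷ fA-zero (inj₂ (inj₂ (d-refl (V 14))))
            ∷ fA≡ 1 (1≤d-local 12 9) (1≤d-local 12 13) (1≤d-local 12 14) (inj₂ (inj₁ (d≤1 (edge 12 13))))
            ∷ fA≡ 1 (1≤d-local 17 9) (1≤d-local 17 13) (1≤d-local 17 14) (inj₂ (inj₁ (d≤1 (edge 17 13))))
            ∷ fA-zero (inj₁ (d-refl (V 9)))
            ∷ [])) ⟨
      planCost d (planA α) + atomIntegral fA (μV α 13) ∎
    where open ≡-Reasoning

  normalisedCurvatureA : ∀ α → α < 1ℚ → κα (planCost d (planA α)) (d (V 12) (V 13)) /ₜ (1ℚ - α) ≡ ℤ.+ 1 / 4
  normalisedCurvatureA α α<1 = begin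
      κα (planCost d (planA α)) (d (V 12) (V 13)) /ₜ (1ℚ - α)  ≡⟨ cong₂ (λ w k → κα w k /ₜ (1ℚ - α)) (cost-planA α) (d-edge 12 13) ⟩
      κα (α + ℕ→ℚ 3 * β α) 1 /ₜ (1ℚ - α)                       ≡⟨ cong (_/ₜ (1ℚ - α)) κα≡ ⟩
      (ℤ.+ 1 / 4 * (1ℚ - α)) /ₜ (1ℚ - α)                         ≡⟨ *-/ₜ-cancelʳ (ℤ.+ 1 / 4) (1ℚ - α) (1-α≢0 α<1) ⟩
      ℤ.+ 1 / 4                                                  ∎
    where
    open ≡-Reasoning
    κα≡ : κα (α + ℕ→ℚ 3 * β α) 1 ≡ ℤ.+ 1 / 4 * (1ℚ - α)
    κα≡ = solve 1 (λ a → con 1ℚ :- (a :+ con (ℕ→ℚ 3) :* βP a) :* con 1ℚ := con (ℤ.+ 1 / 4) :* (con 1ℚ :- a)) refl α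

  curvatureA : HasCurvature G d (V 12) (V 13) (ℤ.+ 1 / 4)
  curvatureA = hasCurvature-eventually-constant {G = G} {d = d} (ℤ.+ 1 / 2) (positive⁻¹ (ℤ.+ 1 / 2)) λ α _ ½<α α<1 →
      planCost d (planA α)
    , isW1-local α 12 13 (planA α) fA
                 (0≤β α α<1 ∷ 0≤α-β α ½<α ∷ 0≤β α α<1 ∷ 0≤β α α<1 ∷ 0≤β α α<1 ∷ 0≤β α α<1 ∷ [])
                 (source-planA α) (target-planA α) fA-Lipschitz (balanceA α)
    , normalisedCurvatureA α α<1

proposition12 : (n : ℕ) → 23 ℕ.≤ n →
    (d : Fin n → Fin n → ℕ) → IsGraphDistance (Cayley n (S₁₄ n)) d →
    (g : Fin n) →
      HasCurvature (Cayley n (S₁₄ n)) d g (g ⊕ 1) (ℤ.+ 1 / 4)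
      × HasCurvature (Cayley n (S₁₄ n)) d g (g ⊕ 4) 0ℚ
proposition12 (suc m) (s≤s 22≤m) d isDist g =
    subst₂ (λ x y → HasCurvature G d x y (ℤ.+ 1 / 4)) (sym g≡V12) (sym (g⊕≡V 1)) curvatureA
  , subst₂ (λ x y → HasCurvature G d x y 0ℚ) (sym g≡V12) (sym (g⊕≡V 4)) curvatureB
  where
  open LocalCoordinates 22≤m g
  open EdgeA 22≤m g isDist
  open EdgeB 22≤m g isDist
  g⊕≡V : ∀ s → g ⊕ s ≡ V (12 ℕ.+ s)
  g⊕≡V s = trans (cong (_⊕ s) g≡V12) (V-+ 12 s)
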